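{- Let $\mathcal H\in\mathrm{FU}(\mathcal S_{\mathrm{BS}})$, let $I\subseteq\mathrm{IF}(\mathcal H)$, let $x\in\mathcal L(f.\mathrm{IF}(\mathcal H))$ be such that $x$ produces a reflexive solution of the halting problem for $\mathcal L(f.I)$ with respect to $\mathcal H$, let $y\in\mathcal L(f.I)$, and let $v\in\{0,1,{:}\}^*$. Then $y\downarrow f.\mathcal H(\triangleright v)$ implies $y\bullet f.\mathcal H(\triangleright v)=x\bullet f.\mathcal H(\triangleright\overline{\mathrm{f2d}(y)}{:}v)$.
   Context: Fix a focus $f$ and a set of method names. For a set $I$ of method names, $\mathcal L(f.I)$ is the set of finite nonempty sequences $x=u_1;\dots;u_k$ of primitive instructions, each of one of the forms $f.m$, $+f.m$, $-f.m$ with $m\in I$; $\#l$ or $\backslash\#l$ with $l\in\mathbb N$; $!t$; $!f$. For such $y$, $\mathrm{f2d}(y)$ is $y$ with every occurrence of $!f$ replaced by $\#0$. Functional units. For a nonempty state set $S$, a method operation is a total function $M:S\to\{\mathsf T,\mathsf F\}\times S$. A functional unit for $S$ is a finite set $\mathcal H$ of pairs $(m,M)$, $m$ a method name and $M$ a method operation, in which no method name occurs twice; $\mathrm{IF}(\mathcal H)$ is the set of method names occurring in $\mathcal H$, and $m_{\mathcal H}$ is the operation paired with $m$. $\mathrm{FU}(S)$ is the set of functional units for $S$. Execution. For $\mathcal H\in\mathrm{FU}(S)$ and $s\in S$, $f.\mathcal H(s)$ is the service family consisting of a single service, named $f$, behaving according to $\mathcal H$ in state $s$. Executing $x=u_1;\dots;u_k$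 on $f.\mathcal H(s)$: current position $i$ (initially $1$), current state (initially $s$). If not $1\le i\le k$, execution deadlocks. If $u_i$ is $f.m$, $+f.m$ or $-f.m$ with $m\notin\mathrm{IF}(\mathcal H)$, execution deadlocks. Otherwise, with $(b,s')=m_{\mathcal H}(\text{current state})$, the state becomes $s'$ and execution proceeds at $i+1$ for $f.m$; at $i+1$ if $b=\mathsf T$ and $i+2$ otherwise for $+f.m$; at $i+2$ if $b=\mathsf T$ and $i+1$ otherwise for $-f.m$. For $\#l$ execution proceeds at $i+l$ (deadlock if $l=0$); for $\backslash\#l$ at $i-l$ (deadlock if $l=0$ or $i-l<1$). On $!t$ (resp. $!f$) execution terminates delivering $\mathsf T$ (resp. $\mathsf F$). $x\downarrow f.\mathcal H(s)$ ($x$ converges) means execution terminates; otherwise $x$ diverges. The reply $x\bullet f.\mathcal H(s)$ is the delivered value if execution terminates and $\mathsf{Div}$ otherwise. Tape states. $\mathcal S_{\mathrm{BS}}=\{v\triangleright w: v,w\in\{0,1,{:}\}^*\}$, with ${:}$ a separator symbol and $\triangleright$ marking the head position; juxtaposition is concatenation. For each $\mathcal H\in\mathrm{FU}(\mathcal S_{\mathrm{BS}})$ a fixed injective encoding $y\mapsto\bar y$ from $\mathcal L(f.\mathrm{IF}(\mathcal H))$ to $\{0,1\}^*$ is given. Halting problem. Let $\mathcal H\in\mathrm{FU}(\mathcal S_{\mathrm{BS}})$ and $I\subseteq\mathrm{IF}(\mathcal H)$. An $x\in\mathcal L(f.\mathrm{IF}(\mathcal H))$ produces a solution of the halting problem for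 $\mathcal L(f.I)$ with respect to $\mathcal H$ if $x\downarrow f.\mathcal H(v)$ for all $v\in\mathcal S_{\mathrm{BS}}$, and for all $y\in\mathcal L(f.I)$ and $v\in\{0,1,{:}\}^*$: $x\bullet f.\mathcal H(\triangleright\bar y{:}v)=\mathsf T\iff y\downarrow f.\mathcal H(\triangleright v)$. It produces a reflexive solution if moreover $x\in\mathcal L(f.I)$. -}

module Defs where

open import Data.Nat using (ℕ; zero; suc; _+_; _∸_; _<_)
open import Data.Bool using (Bool; true; false)
open import Data.Maybe using (Maybe; just; nothing)
open import Data.List using (List; []; _∷_; _++_; map)
open import Data.List.NonEmpty using (List⁺; toList) renaming (map to map⁺)
open import Data.List.Membership.Propositional using (_∈_)
open import Data.List.Relation.Unary.All using (All; []; _∷_)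
import Data.List.Relation.Unary.All as All
open import Data.List.Relation.Unary.Unique.Propositional using (Unique)
open import Data.Product using (Σ; ∃; _×_; _,_; proj₁; proj₂)
open import Data.Empty using (⊥)
open import Data.Unit using (⊤)
open import Relation.Nullary using (¬_)
open import Relation.Binary.PropositionalEquality using (_≡_; _≢_)
open import Function.Bundles using (_⇔_)
open import Function.Definitions using (Injective)

module _ {MName : Set} where

  -- Primitive instructions (the focus f is fixed, hence left implicit).
  data Instr : Set where
    void  : MName → Instr
    ptest : MName → Instr
    ntest : MName → Instr
    fjmp  : ℕ → Instr
    bjmp  : ℕ → Instr
    termT : Instr
    termF : Instr

  InstrIn : (MName → Set) → Instr → Set
  InstrIn P (void m)  = P m
  InstrIn P (ptest m) = P m
  InstrIn P (ntest m) = P m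
  InstrIn P (fjmp _)  = ⊤
  InstrIn P (bjmp _)  = ⊤
  InstrIn P termT     = ⊤
  InstrIn P termF     = ⊤

  L : (MName → Set) → Set
  L P = Σ (List⁺ Instr) (λ y → All (InstrIn P) (toList y))

  f2dI : Instr → Instr
  f2dI termF = fjmp 0
  f2dI u     = u

  f2dI-In : ∀ {P} u → InstrIn P u → InstrIn P (f2dI u)
  f2dI-In (void m)  p = p
  f2dI-In (ptest m) p = p
  f2dI-In (ntest m) p = p
  f2dI-In (fjmp _)  p = p
  f2dI-In (bjmp _)  p = p
  f2dI-In termT     p = p
  f2dI-In termF     p = _

  f2d-All : ∀ {P} (us : List Instr) → All (InstrIn P) us → All (InstrIn P) (map f2dI us)
  f2d-All [] [] = []
  f2d-All (u ∷ us) (p ∷ ps) = f2dI-In u p ∷ f2d-All us ps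

  f2d : ∀ {P} → L P → L P
  f2d (y , ps) = map⁺ f2dI y , f2d-All (toList y) ps

  weakenI : ∀ {P Q : MName → Set} → (∀ {m} → P m → Q m) → ∀ u → InstrIn P u → InstrIn Q u
  weakenI sub (void m)  p = sub p
  weakenI sub (ptest m) p = sub p
  weakenI sub (ntest m) p = sub p
  weakenI sub (fjmp _)  p = p
  weakenI sub (bjmp _)  p = p
  weakenI sub termT     p = p
  weakenI sub termF     p = p

  weakenAll : ∀ {P Q : MName → Set} → (∀ {m} → P m → Q m) → ∀ us → All (InstrIn P) us → All (InstrIn Q) us
  weakenAll sub [] [] = []
  weakenAll sub (u ∷ us) (p ∷ ps) = weakenI sub u p ∷ weakenAll sub us ps

  weaken : ∀ {P Q : MName → Set} → (∀ {m} → P m → Q m) → L P → L Q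
  weaken sub (y , ps) = y , weakenAll sub (toList y) ps

  MethodOp : Set → Set
  MethodOp S = S → Bool × S

  FU : Set → Set
  FU S = Σ (List (MName × MethodOp S)) (λ H → Unique (map proj₁ H))

  IF : ∀ {S} → FU S → List MName
  IF H = map proj₁ (proj₁ H)

  _↦_∈_ : ∀ {S} → MName → MethodOp S → FU S → Set
  m ↦ M ∈ H = (m , M) ∈ proj₁ H

  -- 1-based position lookup; position 0 and positions beyond the end give nothing
  at : List Instr → ℕ → Maybe Instr
  at [] _ = nothing
  at (u ∷ us) zero = nothing
  at (u ∷ us) (suc zero) = just u
  at (u ∷ us) (suc (suc n)) = at us (suc n)

  -- Terminating execution of xs on f.H(s) from position i, delivering b.
  data Runs {S : Set} (xs : List Instr) (H : FU S) : ℕ → S → Bool → Set where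
    r-void  : ∀ {i s m M b s' r} → at xs i ≡ just (void m) → m ↦ M ∈ H → M s ≡ (b , s') →
              Runs xs H (suc i) s' r → Runs xs H i s r
    r-ptT   : ∀ {i s m M s' r} → at xs i ≡ just (ptest m) → m ↦ M ∈ H → M s ≡ (true , s') →
              Runs xs H (suc i) s' r → Runs xs H i s r
    r-ptF   : ∀ {i s m M s' r} → at xs i ≡ just (ptest m) → m ↦ M ∈ H → M s ≡ (false , s') →
              Runs xs H (suc (suc i)) s' r → Runs xs H i s r
    r-ntT   : ∀ {i s m M s' r} → at xs i ≡ just (ntest m) → m ↦ M ∈ H → M s ≡ (true , s') →
              Runs xs H (suc (suc i)) s' r → Runs xs H i s r
    r-ntF   : ∀ {i s m M s' r} → at xs i ≡ just (ntest m) → m ↦ M ∈ H → M s ≡ (false , s') →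
              Runs xs H (suc i) s' r → Runs xs H i s r
    r-fjmp  : ∀ {i s l r} → at xs i ≡ just (fjmp l) → l ≢ 0 →
              Runs xs H (i + l) s r → Runs xs H i s r
    r-bjmp  : ∀ {i s l r} → at xs i ≡ just (bjmp l) → l ≢ 0 → l < i →
              Runs xs H (i ∸ l) s r → Runs xs H i s r
    r-termT : ∀ {i s} → at xs i ≡ just termT → Runs xs H i s true
    r-termF : ∀ {i s} → at xs i ≡ just termF → Runs xs H i s false

  Conv : ∀ {S} → List⁺ Instr → FU S → S → Set
  Conv x H s = ∃ λ b → Runs (toList x) H 1 s b

  data Reply : Set where
    val : Bool → Reply
    Div : Reply

  ReplyIs : ∀ {S} → List⁺ Instr → FU S → S → Reply → Set
  ReplyIs x H s (val b) = Runs (toList x) H 1 s b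
  ReplyIs x H s Div     = ¬ Conv x H s

data Sym : Set where
  𝟎 𝟏 sep : Sym

record SBS : Set where
  constructor _▷_
  field
    left  : List Sym
    right : List Sym

bit : Bool → Sym
bit false = 𝟎
bit true  = 𝟏

-- ▷ ȳ : v, with the code ȳ ∈ {0,1}* given as a list of booleans
codeTape : List Bool → List Sym → SBS
codeTape c v = [] ▷ (map bit c ++ (sep ∷ v))

module _ {MName : Set} where

  ReflexiveSolution : (H : FU {MName} SBS) (I : MName → Set) (sub : ∀ {m} → I m → m ∈ IF H)
                      (enc : L (λ m → m ∈ IF H) → List Bool) (x : L (λ m → m ∈ IF H)) → Set
  ReflexiveSolution H I sub enc x =
    (∀ (s : SBS) → Conv (proj₁ x) H s) ×
    (∀ (y : L I) (v : List Sym) →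
       ReplyIs (proj₁ x) H (codeTape (enc (weaken sub y)) v) (val true) ⇔ Conv (proj₁ y) H ([] ▷ v)) ×
    All (InstrIn I) (toList (proj₁ x))

-- If y converges it delivers T or F. If T, then f2d(y) runs exactly as y does and also
-- delivers T, so x delivers T on the code of f2d(y). If F, then f2d(y) diverges: a
-- terminating run of f2d(y) never meets the #0 replacing !f, so it is also a run of y,
-- necessarily ending in !t, contradicting determinism. Hence x, being total, delivers F.
module Submission where

open import Defs
open import Data.Bool using (Bool; true; false)
open import Data.Nat using (ℕ; zero; suc; _+_; _∸_; _<_)
open import Data.List using (List; []; _∷_; map)
open import Data.List.NonEmpty using (toList)
open import Data.Maybe using (just)
open import Data.Maybe.Properties using (just-injective)
open import Data.List.Membership.Propositional using (_∈_)
open import Data.List.Membership.Propositional.Properties using (∈-map⁺)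
open import Data.List.Relation.Unary.Any using (here; there)
open import Data.List.Relation.Unary.Unique.Propositional using (Unique)
open import Data.List.Relation.Unary.Unique.Propositional.Properties using (Unique[x∷xs]⇒x∉xs)
open import Data.List.Relation.Unary.AllPairs using (_∷_)
open import Data.Product using (∃; ∃₂; _×_; _,_; proj₁; proj₂)
open import Data.Sum using (_⊎_; inj₁; inj₂)
open import Data.Empty using (⊥-elim)
open import Function.Bundles using (_⇔_; mk⇔; Equivalence)
open import Function.Definitions using (Injective)
open import Relation.Nullary using (¬_)
open import Relation.Binary.PropositionalEquality using (_≡_; _≢_; refl; sym; trans; cong; subst)

unique-keys⇒functional : {A B : Set} {xs : List (A × B)} {a : A} {b b′ : B} →
                         Unique (map proj₁ xs) → (a , b) ∈ xs → (a , b′) ∈ xs → b ≡ b′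
unique-keys⇒functional _        (here refl) (here refl) = refl
unique-keys⇒functional u        (here refl) (there p)   = ⊥-elim (Unique[x∷xs]⇒x∉xs u (∈-map⁺ proj₁ p))
unique-keys⇒functional u        (there p)   (here refl) = ⊥-elim (Unique[x∷xs]⇒x∉xs u (∈-map⁺ proj₁ p))
unique-keys⇒functional (_ ∷ u)  (there p)   (there q)   = unique-keys⇒functional u p q

module _ {MName : Set} {S : Set} (H : FU {MName} S) where

  method-result : ∀ {m M M′ s r r′} → m ↦ M ∈ H → M s ≡ r → m ↦ M′ ∈ H → M′ s ≡ r′ → r ≡ r′
  method-result h q h′ q′ with refl ← unique-keys⇒functional (proj₂ H) h h′ = trans (sym q) q′

  -- Single steps of execution, split off from Runs so that determinism is proved per instruction.
  data Step : Instr {MName} → ℕ → S → ℕ → S → Set where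
    s-void : ∀ {m M i s b s′} → m ↦ M ∈ H → M s ≡ (b , s′) → Step (void m) i s (suc i) s′
    s-ptT  : ∀ {m M i s s′} → m ↦ M ∈ H → M s ≡ (true , s′) → Step (ptest m) i s (suc i) s′
    s-ptF  : ∀ {m M i s s′} → m ↦ M ∈ H → M s ≡ (false , s′) → Step (ptest m) i s (suc (suc i)) s′
    s-ntT  : ∀ {m M i s s′} → m ↦ M ∈ H → M s ≡ (true , s′) → Step (ntest m) i s (suc (suc i)) s′
    s-ntF  : ∀ {m M i s s′} → m ↦ M ∈ H → M s ≡ (false , s′) → Step (ntest m) i s (suc i) s′
    s-fjmp : ∀ {l i s} → l ≢ 0 → Step (fjmp l) i s (i + l) s
    s-bjmp : ∀ {l i s} → l ≢ 0 → l < i → Step (bjmp l) i s (i ∸ l) s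

  Step-deterministic : ∀ {u i s i₁ s₁ i₂ s₂} → Step u i s i₁ s₁ → Step u i s i₂ s₂ → i₁ ≡ i₂ × s₁ ≡ s₂
  Step-deterministic (s-void h q) (s-void h′ q′) with refl ← method-result h q h′ q′ = refl , refl
  Step-deterministic (s-ptT h q)  (s-ptT h′ q′)  with refl ← method-result h q h′ q′ = refl , refl
  Step-deterministic (s-ptT h q)  (s-ptF h′ q′)  with () ← method-result h q h′ q′
  Step-deterministic (s-ptF h q)  (s-ptT h′ q′)  with () ← method-result h q h′ q′
  Step-deterministic (s-ptF h q)  (s-ptF h′ q′)  with refl ← method-result h q h′ q′ = refl , refl
  Step-deterministic (s-ntT h q)  (s-ntT h′ q′)  with refl ← method-result h q h′ q′ = refl , refl
  Step-deterministic (s-ntT h q)  (s-ntF h′ q′)  with () ← method-result h q h′ q′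
  Step-deterministic (s-ntF h q)  (s-ntT h′ q′)  with () ← method-result h q h′ q′
  Step-deterministic (s-ntF h q)  (s-ntF h′ q′)  with refl ← method-result h q h′ q′ = refl , refl
  Step-deterministic (s-fjmp _)   (s-fjmp _)     = refl , refl
  Step-deterministic (s-bjmp _ _) (s-bjmp _ _)   = refl , refl

  data Halts : Instr {MName} → Bool → Set where
    halts-t : Halts termT true
    halts-f : Halts termF false

  Halts-deterministic : ∀ {u b c} → Halts u b → Halts u c → b ≡ c
  Halts-deterministic halts-t halts-t = refl
  Halts-deterministic halts-f halts-f = refl

  Halts⇒¬Step : ∀ {u b i s i′ s′} → Halts u b → ¬ Step u i s i′ s′
  Halts⇒¬Step halts-t ()
  Halts⇒¬Step halts-f ()

  module _ {xs : List (Instr {MName})} where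

    Runs-view : ∀ {i s b} → Runs xs H i s b →
                ∃ λ u → at xs i ≡ just u × (Halts u b ⊎ ∃₂ λ i′ s′ → Step u i s i′ s′ × Runs xs H i′ s′ b)
    Runs-view (r-void e h q k)   = _ , e , inj₂ (_ , _ , s-void h q , k)
    Runs-view (r-ptT e h q k)    = _ , e , inj₂ (_ , _ , s-ptT h q , k)
    Runs-view (r-ptF e h q k)    = _ , e , inj₂ (_ , _ , s-ptF h q , k)
    Runs-view (r-ntT e h q k)    = _ , e , inj₂ (_ , _ , s-ntT h q , k)
    Runs-view (r-ntF e h q k)    = _ , e , inj₂ (_ , _ , s-ntF h q , k)
    Runs-view (r-fjmp e n k)     = _ , e , inj₂ (_ , _ , s-fjmp n , k)
    Runs-view (r-bjmp e n lt k)  = _ , e , inj₂ (_ , _ , s-bjmp n lt , k)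
    Runs-view (r-termT e)        = _ , e , inj₁ halts-t
    Runs-view (r-termF e)        = _ , e , inj₁ halts-f

    Runs-after-Step : ∀ {u i s i′ s′ c} → at xs i ≡ just u → Step u i s i′ s′ →
                      Runs xs H i s c → Runs xs H i′ s′ c
    Runs-after-Step e st r with Runs-view r
    ... | _ , e′ , inj₁ h with refl ← just-injective (trans (sym e) e′) = ⊥-elim (Halts⇒¬Step h st)
    ... | _ , e′ , inj₂ (_ , _ , st′ , k) with refl ← just-injective (trans (sym e) e′)
                                          with refl , refl ← Step-deterministic st st′ = k

    Runs-at-Halts : ∀ {u i s b c} → at xs i ≡ just u → Halts u b → Runs xs H i s c → b ≡ c
    Runs-at-Halts e h r with Runs-view r
    ... | _ , e′ , inj₁ h′ with refl ← just-injective (trans (sym e) e′) = Halts-deterministic h h′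
    ... | _ , e′ , inj₂ (_ , _ , st , _) with refl ← just-injective (trans (sym e) e′) =
      ⊥-elim (Halts⇒¬Step h st)

    Runs-deterministic : ∀ {i s b c} → Runs xs H i s b → Runs xs H i s c → b ≡ c
    Runs-deterministic (r-void e h q k)  r = Runs-deterministic k (Runs-after-Step e (s-void h q) r)
    Runs-deterministic (r-ptT e h q k)   r = Runs-deterministic k (Runs-after-Step e (s-ptT h q) r)
    Runs-deterministic (r-ptF e h q k)   r = Runs-deterministic k (Runs-after-Step e (s-ptF h q) r)
    Runs-deterministic (r-ntT e h q k)   r = Runs-deterministic k (Runs-after-Step e (s-ntT h q) r)
    Runs-deterministic (r-ntF e h q k)   r = Runs-deterministic k (Runs-after-Step e (s-ntF h q) r)
    Runs-deterministic (r-fjmp e n k)    r = Runs-deterministic k (Runs-after-Step e (s-fjmp n) r)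
    Runs-deterministic (r-bjmp e n lt k) r = Runs-deterministic k (Runs-after-Step e (s-bjmp n lt) r)
    Runs-deterministic (r-termT e)       r = Runs-at-Halts e halts-t r
    Runs-deterministic (r-termF e)       r = Runs-at-Halts e halts-f r

module _ {MName : Set} where

  at-map⁺ : ∀ (φ : Instr {MName} → Instr {MName}) ys i {u} → at ys i ≡ just u → at (map φ ys) i ≡ just (φ u)
  at-map⁺ φ (_ ∷ _)  (suc zero)    refl = refl
  at-map⁺ φ (_ ∷ ys) (suc (suc i)) e    = at-map⁺ φ ys (suc i) e

  at-map⁻ : ∀ (φ : Instr {MName} → Instr {MName}) ys i {w} → at (map φ ys) i ≡ just w →
            ∃ λ u → at ys i ≡ just u × φ u ≡ w
  at-map⁻ φ (y ∷ _)  (suc zero)    e = y , refl , just-injective e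
  at-map⁻ φ (_ ∷ ys) (suc (suc i)) e = at-map⁻ φ ys (suc i) e

  f2dI-fixes : ∀ {u w : Instr {MName}} → f2dI u ≡ w → w ≢ fjmp 0 → u ≡ w
  f2dI-fixes {void _}  refl _ = refl
  f2dI-fixes {ptest _} refl _ = refl
  f2dI-fixes {ntest _} refl _ = refl
  f2dI-fixes {fjmp _}  refl _ = refl
  f2dI-fixes {bjmp _}  refl _ = refl
  f2dI-fixes {termT}   refl _ = refl
  f2dI-fixes {termF}   refl n = ⊥-elim (n refl)

  f2dI≢termF : ∀ (u : Instr {MName}) → f2dI u ≢ termF
  f2dI≢termF termF ()

  at-f2d⁻ : ∀ ys i {w} → at (map f2dI ys) i ≡ just w → w ≢ fjmp 0 → at ys i ≡ just w
  at-f2d⁻ ys i e n with u , e′ , refl ← at-map⁻ f2dI ys i e = trans e′ (cong just (f2dI-fixes refl n))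

  at-f2d≢termF : ∀ ys i → at (map f2dI ys) i ≢ just termF
  at-f2d≢termF ys i e with u , _ , eq ← at-map⁻ f2dI ys i e = f2dI≢termF u eq

  module _ {S : Set} {H : FU {MName} S} {ys : List (Instr {MName})} where

    Runs-f2d⁺ : ∀ {i s} → Runs ys H i s true → Runs (map f2dI ys) H i s true
    Runs-f2d⁺ {i} (r-void e h q k)  = r-void (at-map⁺ f2dI ys i e) h q (Runs-f2d⁺ k)
    Runs-f2d⁺ {i} (r-ptT e h q k)   = r-ptT (at-map⁺ f2dI ys i e) h q (Runs-f2d⁺ k)
    Runs-f2d⁺ {i} (r-ptF e h q k)   = r-ptF (at-map⁺ f2dI ys i e) h q (Runs-f2d⁺ k)
    Runs-f2d⁺ {i} (r-ntT e h q k)   = r-ntT (at-map⁺ f2dI ys i e) h q (Runs-f2d⁺ k)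
    Runs-f2d⁺ {i} (r-ntF e h q k)   = r-ntF (at-map⁺ f2dI ys i e) h q (Runs-f2d⁺ k)
    Runs-f2d⁺ {i} (r-fjmp e n k)    = r-fjmp (at-map⁺ f2dI ys i e) n (Runs-f2d⁺ k)
    Runs-f2d⁺ {i} (r-bjmp e n lt k) = r-bjmp (at-map⁺ f2dI ys i e) n lt (Runs-f2d⁺ k)
    Runs-f2d⁺ {i} (r-termT e)       = r-termT (at-map⁺ f2dI ys i e)

    Runs-f2d⁻ : ∀ {i s b} → Runs (map f2dI ys) H i s b → Runs ys H i s true
    Runs-f2d⁻ {i} (r-void e h q k)  = r-void (at-f2d⁻ ys i e λ ()) h q (Runs-f2d⁻ k)
    Runs-f2d⁻ {i} (r-ptT e h q k)   = r-ptT (at-f2d⁻ ys i e λ ()) h q (Runs-f2d⁻ k)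
    Runs-f2d⁻ {i} (r-ptF e h q k)   = r-ptF (at-f2d⁻ ys i e λ ()) h q (Runs-f2d⁻ k)
    Runs-f2d⁻ {i} (r-ntT e h q k)   = r-ntT (at-f2d⁻ ys i e λ ()) h q (Runs-f2d⁻ k)
    Runs-f2d⁻ {i} (r-ntF e h q k)   = r-ntF (at-f2d⁻ ys i e λ ()) h q (Runs-f2d⁻ k)
    Runs-f2d⁻ {i} (r-fjmp e n k)    = r-fjmp (at-f2d⁻ ys i e λ { refl → n refl }) n (Runs-f2d⁻ k)
    Runs-f2d⁻ {i} (r-bjmp e n lt k) = r-bjmp (at-f2d⁻ ys i e λ ()) n lt (Runs-f2d⁻ k)
    Runs-f2d⁻ {i} (r-termT e)       = r-termT (at-f2d⁻ ys i e λ ())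
    Runs-f2d⁻ {i} (r-termF e)       = ⊥-elim (at-f2d≢termF ys i e)

lemma2 : {MName : Set} (H : FU {MName} SBS) (I : MName → Set) (sub : ∀ {m} → I m → m ∈ IF H)
         (enc : L (λ m → m ∈ IF H) → List Bool) → Injective _≡_ _≡_ enc →
         (x : L (λ m → m ∈ IF H)) → ReflexiveSolution H I sub enc x →
         (y : L I) (v : List Sym) → Conv (proj₁ y) H ([] ▷ v) →
         (r : Reply) → ReplyIs (proj₁ y) H ([] ▷ v) r ⇔ ReplyIs (proj₁ x) H (codeTape (enc (weaken sub (f2d y))) v) r
lemma2 H I sub enc _ x (total , solves , _) y v (b , run-y) = reply
  where
  tape = codeTape (enc (weaken sub (f2d y))) v
  decides = solves (f2d y) v

  x-agrees : ∀ {c} → Runs (toList (proj₁ y)) H 1 ([] ▷ v) c → Runs (toList (proj₁ x)) H 1 tape c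
  x-agrees {true}  run = Equivalence.from decides (true , Runs-f2d⁺ run)
  x-agrees {false} run with total tape
  ... | false , run-x = run-x
  ... | true  , run-x with () ← Runs-deterministic H (Runs-f2d⁻ (proj₂ (Equivalence.to decides run-x))) run

  reply : (r : Reply) → ReplyIs (proj₁ y) H ([] ▷ v) r ⇔ ReplyIs (proj₁ x) H tape r
  reply (val c) = mk⇔ x-agrees λ run-x →
    subst (Runs (toList (proj₁ y)) H 1 ([] ▷ v)) (Runs-deterministic H (x-agrees run-y) run-x) run-y
  reply Div = mk⇔ (λ diverges → ⊥-elim (diverges (b , run-y))) (λ diverges → ⊥-elim (diverges (total tape)))
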